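{- Let $G$ be the bipartite graph with left vertices $u_1,u_2,u_3$, right vertices $v_1,v_2$, and edges $u_1v_1,\ u_1v_2,\ u_2v_1,\ u_3v_1,\ u_3v_2$ (and no others). Then there exist $n,k\in\mathbb{N}$ with $k\le n$ such that for every $2$-coloring of the edges of $B_{n,k}$ there exists a set of vertices of $B_{n,k}$ whose induced subgraph is isomorphic to $G$ and all of whose edges receive the same color.
   Context: For $n\in\mathbb{N}$ write $[n]=\{1,\dots,n\}$, and for a set $X$ write $\binom{X}{k}$ for the set of $k$-element subsets of $X$. For $k\le n$, $B_{n,k}$ denotes the bipartite graph with left vertex set $[n]$, right vertex set $\binom{[n]}{k}$, and edge set $\{(x,X)\in[n]\times\binom{[n]}{k} : x\in X\}$. A subgraph $H=(V',E')$ of a graph $G=(V,E)$ with $V'\subseteq V$ is induced if $E'$ consists of all edges of $G$ with both endpoints in $V'$. A $2$-coloring of the edges is any map from the edge set to a $2$-element set of colors. -}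

module Defs where

open import Data.Nat using (ℕ)
open import Data.Fin using (Fin; zero; suc)
open import Data.Fin.Subset using (Subset; _∈_; ∣_∣)
open import Data.Sum using (_⊎_; inj₁; inj₂)
open import Data.Product using (Σ; _,_; _×_)
open import Data.Empty using (⊥)
open import Data.Bool using (Bool)
open import Relation.Binary.PropositionalEquality using (_≡_)

KSubset : ℕ → ℕ → Set
KSubset n k = Σ (Subset n) (λ X → ∣ X ∣ ≡ k)

BVertex : ℕ → ℕ → Set
BVertex n k = Fin n ⊎ KSubset n k

BAdj : ∀ {n k} → BVertex n k → BVertex n k → Set
BAdj (inj₁ x) (inj₂ (X , _)) = x ∈ X
BAdj (inj₂ (X , _)) (inj₁ x) = x ∈ X
BAdj (inj₁ _) (inj₁ _) = ⊥
BAdj (inj₂ _) (inj₂ _) = ⊥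

Colouring : ℕ → ℕ → Set
Colouring n k = (x : Fin n) → (X : KSubset n k) → x ∈ Data.Product.proj₁ X → Bool

-- The graph G: left u1,u2,u3 (Fin 3: 0,1,2), right v1,v2 (Fin 2: 0,1)
-- edges u1v1, u1v2, u2v1, u3v1, u3v2
data GEdge : Fin 3 → Fin 2 → Set where
  u1v1 : GEdge zero zero
  u1v2 : GEdge zero (suc zero)
  u2v1 : GEdge (suc zero) zero
  u3v1 : GEdge (suc (suc zero)) zero
  u3v2 : GEdge (suc (suc zero)) (suc zero)

GVertex : Set
GVertex = Fin 3 ⊎ Fin 2

GAdj : GVertex → GVertex → Set
GAdj (inj₁ u) (inj₂ v) = GEdge u v
GAdj (inj₂ v) (inj₁ u) = GEdge u v
GAdj (inj₁ _) (inj₁ _) = ⊥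
GAdj (inj₂ _) (inj₂ _) = ⊥

-- An induced copy of G in B_{n,k}: an injective vertex map f with
-- G-adjacency ⇔ B-adjacency of images (so the induced subgraph on the
-- image of f is isomorphic to G via f).
record InducedCopy (n k : ℕ) : Set where
  field
    f         : GVertex → BVertex n k
    injective : ∀ a b → f a ≡ f b → a ≡ b
    preserves : ∀ a b → GAdj a b → BAdj (f a) (f b)
    reflects  : ∀ a b → BAdj (f a) (f b) → GAdj a b

Monochromatic : ∀ {n k} → Colouring n k → InducedCopy n k → Bool → Set
Monochromatic {n} {k} c C col =
  ∀ a b (x : Fin n) (X : KSubset n k) (p : x ∈ Data.Product.proj₁ X) →
  InducedCopy.f C a ≡ inj₁ x → InducedCopy.f C b ≡ inj₂ X → c x X p ≡ col

-- G is embedded with u₁, u₂, u₃ as k-sets A, B, C and v₁, v₂ as elements p, q: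
-- p, q ∈ A, C with A ≠ C, and p ∈ B ∌ q, all five edges of one colour.
-- In B₃₈,₆ fix a five-element core and the 33 sets Yᵢ = core ∪ {petal i}.  Their
-- colour patterns on the core take only 2⁵ values, so some Yᵢ ≠ Yⱼ share one, and
-- three core elements s₁, s₂, s₃ get a common colour b in both.  With Yᵢ, Yⱼ as
-- A and C, a set containing sₐ but not s₃ (a = 1, 2), or s₁ but not s₂, whose
-- edge to sₐ (resp. s₁) has colour b completes a copy.  Otherwise two sets
-- Z, Z' ⊇ {s₁, s₂} avoiding s₃ and a set W ∋ s₁ avoiding s₂ have all those edges
-- coloured not b, and s₁, s₂ with Z, W, Z' form a copy of colour not b.
module Submission where

open import Defs
open import Data.Nat using (ℕ; _≤_; _+_; _∸_; _^_)
open import Data.Nat.Properties using (n<1+n; m≤m+n)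
open import Data.Bool using (Bool; not)
open import Data.Bool.Properties using (¬-not) renaming (_≟_ to _≟ᴮ_)
open import Data.Fin using (Fin; suc; _↑ˡ_; _↑ʳ_; funToFin; finToFun)
open import Data.Fin.Patterns using (0F; 1F; 2F; 3F; 4F)
open import Data.Fin.Properties using (pigeonhole; <⇒≢; finToFun-funToFin; 2↔Bool)
open import Data.Fin.Subset using (Subset; inside; outside; _∈_; _∉_; ∣_∣; ⁅_⁆; ⊤; ⊥; ∁)
open import Data.Fin.Subset.Properties
  using (∈⊤; x∈⁅x⁆; x∈⁅y⁆⇒x≡y; x≢y⇒x∉⁅y⁆; ∣⁅x⁆∣≡1; ∣∁p∣≡n∸∣p∣; x∉p⇒x∈∁p; x∈∁p⇒x∉p)
open import Data.Vec using (_∷_; []; _++_; here; there)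
open import Data.Vec.Properties.WithK using ([]=-irrelevant)
open import Data.Product using (Σ; ∃; ∃₂; _×_; _,_; proj₁)
open import Data.Sum using (_⊎_; inj₁; inj₂)
open import Data.Sum.Properties using (inj₁-injective; inj₂-injective)
open import Function using (_∘_; Inverse)
open import Function.Definitions using (Injective)
open import Relation.Binary.PropositionalEquality
open import Relation.Nullary using (yes; no; contradiction)

private
  variable
    m n k : ℕ

∈-++⁺ˡ : {x : Fin m} {p : Subset m} {q : Subset n} → x ∈ p → x ↑ˡ n ∈ p ++ q
∈-++⁺ˡ here        = here
∈-++⁺ˡ (there x∈p) = there (∈-++⁺ˡ x∈p)

∈-++⁻ˡ : {x : Fin m} {p : Subset m} {q : Subset n} → x ↑ˡ n ∈ p ++ q → x ∈ p
∈-++⁻ˡ {x = 0F}    {_ ∷ _} here           = here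
∈-++⁻ˡ {x = suc x} {_ ∷ _} (there x∈p++q) = there (∈-++⁻ˡ x∈p++q)

∈-++⁺ʳ : {x : Fin n} (p : Subset m) {q : Subset n} → x ∈ q → m ↑ʳ x ∈ p ++ q
∈-++⁺ʳ []      x∈q = x∈q
∈-++⁺ʳ (_ ∷ p) x∈q = there (∈-++⁺ʳ p x∈q)

∈-++⁻ʳ : {x : Fin n} (p : Subset m) {q : Subset n} → m ↑ʳ x ∈ p ++ q → x ∈ q
∈-++⁻ʳ []      x∈q            = x∈q
∈-++⁻ʳ (_ ∷ p) (there x∈p++q) = ∈-++⁻ʳ p x∈p++q

∣p++q∣≡∣p∣+∣q∣ : (p : Subset m) (q : Subset n) → ∣ p ++ q ∣ ≡ ∣ p ∣ + ∣ q ∣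
∣p++q∣≡∣p∣+∣q∣ []            q = refl
∣p++q∣≡∣p∣+∣q∣ (inside  ∷ p) q = cong (1 +_) (∣p++q∣≡∣p∣+∣q∣ p q)
∣p++q∣≡∣p∣+∣q∣ (outside ∷ p) q = ∣p++q∣≡∣p∣+∣q∣ p q

module _ where
  open Inverse 2↔Bool using (to; from; strictlyInverseˡ)

  encode : (Fin m → Bool) → Fin (2 ^ m)
  encode g = funToFin (from ∘ g)

  encode-injective : {g h : Fin m → Bool} → encode g ≡ encode h → g ≗ h
  encode-injective {g = g} {h} e s = begin
    g s                        ≡⟨ strictlyInverseˡ (g s) ⟨
    to (from (g s))            ≡⟨ cong to (finToFun-funToFin (from ∘ g) s) ⟨
    to (finToFun (encode g) s) ≡⟨ cong (λ t → to (finToFun t s)) e ⟩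
    to (finToFun (encode h) s) ≡⟨ cong to (finToFun-funToFin (from ∘ h) s) ⟩
    to (from (h s))            ≡⟨ strictlyInverseˡ (h s) ⟩
    h s                        ∎
    where open ≡-Reasoning

boolVec-pigeonhole : (f : Fin (1 + 2 ^ m) → Fin m → Bool) → ∃₂ λ i j → i ≢ j × f i ≗ f j
boolVec-pigeonhole {m} f with i , j , i<j , e ← pigeonhole (n<1+n (2 ^ m)) (encode ∘ f) =
  i , j , <⇒≢ i<j , encode-injective e

≡-or-≡not : (a b : Bool) → a ≡ b ⊎ a ≡ not b
≡-or-≡not a b with a ≟ᴮ b
... | yes a≡b = inj₁ a≡b
... | no  a≢b = inj₂ (¬-not a≢b)

record MonochromaticTriple (g : Fin m → Bool) (b : Bool) : Set where
  constructor triple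
  field
    s₁ s₂ s₃ : Fin m
    s₁≢s₂ : s₁ ≢ s₂
    s₁≢s₃ : s₁ ≢ s₃
    s₂≢s₃ : s₂ ≢ s₃
    g-s₁  : g s₁ ≡ b
    g-s₂  : g s₂ ≡ b
    g-s₃  : g s₃ ≡ b

-- Compare every value with g 0: either two of the others agree with it, or
-- three of them disagree (and so agree with each other).
three-equal : (g : Fin 5 → Bool) → ∃ (MonochromaticTriple g)
three-equal g
  with ≡-or-≡not (g 1F) (g 0F) | ≡-or-≡not (g 2F) (g 0F)
     | ≡-or-≡not (g 3F) (g 0F) | ≡-or-≡not (g 4F) (g 0F)
... | inj₁ e₁ | inj₁ e₂ | _       | _       = _ , triple 0F 1F 2F (λ ()) (λ ()) (λ ()) refl e₁ e₂
... | inj₁ e₁ | inj₂ _  | inj₁ e₃ | _       = _ , triple 0F 1F 3F (λ ()) (λ ()) (λ ()) refl e₁ e₃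
... | inj₁ e₁ | inj₂ _  | inj₂ _  | inj₁ e₄ = _ , triple 0F 1F 4F (λ ()) (λ ()) (λ ()) refl e₁ e₄
... | inj₁ _  | inj₂ e₂ | inj₂ e₃ | inj₂ e₄ = _ , triple 2F 3F 4F (λ ()) (λ ()) (λ ()) e₂ e₃ e₄
... | inj₂ _  | inj₁ e₂ | inj₁ e₃ | _       = _ , triple 0F 2F 3F (λ ()) (λ ()) (λ ()) refl e₂ e₃
... | inj₂ _  | inj₁ e₂ | inj₂ _  | inj₁ e₄ = _ , triple 0F 2F 4F (λ ()) (λ ()) (λ ()) refl e₂ e₄
... | inj₂ e₁ | inj₁ _  | inj₂ e₃ | inj₂ e₄ = _ , triple 1F 3F 4F (λ ()) (λ ()) (λ ()) e₁ e₃ e₄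
... | inj₂ _  | inj₂ _  | inj₁ e₃ | inj₁ e₄ = _ , triple 0F 3F 4F (λ ()) (λ ()) (λ ()) refl e₃ e₄
... | inj₂ e₁ | inj₂ e₂ | inj₂ e₃ | _       = _ , triple 1F 2F 3F (λ ()) (λ ()) (λ ()) e₁ e₂ e₃
... | inj₂ e₁ | inj₂ e₂ | inj₁ _  | inj₂ e₄ = _ , triple 1F 2F 4F (λ ()) (λ ()) (λ ()) e₁ e₂ e₄

HasMonochromaticCopy : Colouring n k → Set
HasMonochromaticCopy {n} {k} c = Σ (InducedCopy n k) (λ C → ∃ (Monochromatic c C))

module Embedding {S : Fin 3 → KSubset n k} {x : Fin 2 → Fin n}
         (S-injective : Injective _≡_ _≡_ S) (x-injective : Injective _≡_ _≡_ x)
         (edge⇒∈ : ∀ {u v} → GEdge u v → x v ∈ proj₁ (S u))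
         (∈⇒edge : ∀ {u v} → x v ∈ proj₁ (S u) → GEdge u v) where

  embed : GVertex → BVertex n k
  embed (inj₁ u) = inj₂ (S u)
  embed (inj₂ v) = inj₁ (x v)

  embed-injective : ∀ a b → embed a ≡ embed b → a ≡ b
  embed-injective (inj₁ _) (inj₁ _) e = cong inj₁ (S-injective (inj₂-injective e))
  embed-injective (inj₂ _) (inj₂ _) e = cong inj₂ (x-injective (inj₁-injective e))
  embed-injective (inj₁ _) (inj₂ _) ()
  embed-injective (inj₂ _) (inj₁ _) ()

  embed-preserves : ∀ a b → GAdj a b → BAdj (embed a) (embed b)
  embed-preserves (inj₁ _) (inj₂ _) e = edge⇒∈ e
  embed-preserves (inj₂ _) (inj₁ _) e = edge⇒∈ e

  embed-reflects : ∀ a b → BAdj (embed a) (embed b) → GAdj a b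
  embed-reflects (inj₁ _) (inj₂ _) x∈S = ∈⇒edge x∈S
  embed-reflects (inj₂ _) (inj₁ _) x∈S = ∈⇒edge x∈S

  inducedCopy : InducedCopy n k
  inducedCopy = record
    { f = embed ; injective = embed-injective ; preserves = embed-preserves ; reflects = embed-reflects }

  -- Membership proofs are unique, so colours along the proofs edge⇒∈ determine all of them.
  inducedCopy-monochromatic : (c : Colouring n k) {b : Bool} →
    (∀ {u v} (e : GEdge u v) → c (x v) (S u) (edge⇒∈ e) ≡ b) → Monochromatic c inducedCopy b
  inducedCopy-monochromatic c colours (inj₂ v) (inj₁ u) _ _ x∈S refl refl =
    trans (cong (c (x v) (S u)) ([]=-irrelevant x∈S (edge⇒∈ (∈⇒edge x∈S)))) (colours (∈⇒edge x∈S))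
  inducedCopy-monochromatic c colours (inj₁ _) _        _ _ _ () _
  inducedCopy-monochromatic c colours (inj₂ _) (inj₂ _) _ _ _ _  ()

record CommonSets (c : Colouring n k) (b : Bool) (p q : Fin n) : Set where
  constructor commonSets
  field
    A C : KSubset n k
    A≢C : A ≢ C
    p∈A : p ∈ proj₁ A
    q∈A : q ∈ proj₁ A
    p∈C : p ∈ proj₁ C
    q∈C : q ∈ proj₁ C
    pA  : c p A p∈A ≡ b
    qA  : c q A q∈A ≡ b
    pC  : c p C p∈C ≡ b
    qC  : c q C q∈C ≡ b

monochromaticCopy : {c : Colouring n k} {b : Bool} {p q : Fin n} → CommonSets c b p q →
  (B : KSubset n k) (p∈B : p ∈ proj₁ B) → q ∉ proj₁ B → c p B p∈B ≡ b → HasMonochromaticCopy c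
monochromaticCopy {n = n} {k} {c} {b} {p} {q}
  (commonSets A C A≢C p∈A q∈A p∈C q∈C pA qA pC qC) B p∈B q∉B pB =
  inducedCopy , b , inducedCopy-monochromatic c colours
  where
  S : Fin 3 → KSubset n k
  S 0F = A
  S 1F = B
  S 2F = C

  x : Fin 2 → Fin n
  x 0F = p
  x 1F = q

  A≢B : A ≢ B
  A≢B refl = q∉B q∈A

  C≢B : C ≢ B
  C≢B refl = q∉B q∈C

  S-injective : Injective _≡_ _≡_ S
  S-injective {0F} {0F} _   = refl
  S-injective {1F} {1F} _   = refl
  S-injective {2F} {2F} _   = refl
  S-injective {0F} {1F} A≡B = contradiction A≡B A≢B
  S-injective {1F} {0F} B≡A = contradiction (sym B≡A) A≢B
  S-injective {2F} {1F} C≡B = contradiction C≡B C≢B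
  S-injective {1F} {2F} B≡C = contradiction (sym B≡C) C≢B
  S-injective {0F} {2F} A≡C = contradiction A≡C A≢C
  S-injective {2F} {0F} C≡A = contradiction (sym C≡A) A≢C

  x-injective : Injective _≡_ _≡_ x
  x-injective {0F} {0F} _   = refl
  x-injective {1F} {1F} _   = refl
  x-injective {0F} {1F} refl = contradiction p∈B q∉B
  x-injective {1F} {0F} refl = contradiction p∈B q∉B

  edge⇒∈ : ∀ {u v} → GEdge u v → x v ∈ proj₁ (S u)
  edge⇒∈ u1v1 = p∈A
  edge⇒∈ u1v2 = q∈A
  edge⇒∈ u2v1 = p∈B
  edge⇒∈ u3v1 = p∈C
  edge⇒∈ u3v2 = q∈C

  ∈⇒edge : ∀ {u v} → x v ∈ proj₁ (S u) → GEdge u v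
  ∈⇒edge {0F} {0F} _   = u1v1
  ∈⇒edge {0F} {1F} _   = u1v2
  ∈⇒edge {1F} {0F} _   = u2v1
  ∈⇒edge {1F} {1F} q∈B = contradiction q∈B q∉B
  ∈⇒edge {2F} {0F} _   = u3v1
  ∈⇒edge {2F} {1F} _   = u3v2

  colours : ∀ {u v} (e : GEdge u v) → c (x v) (S u) (edge⇒∈ e) ≡ b
  colours u1v1 = pA
  colours u1v2 = qA
  colours u2v1 = pB
  colours u3v1 = pC
  colours u3v2 = qC

  open Embedding S-injective x-injective edge⇒∈ ∈⇒edge

monochromaticCopy-triple : {c : Colouring n k} {b : Bool} {x₁ x₂ x₃ : Fin n} →
  CommonSets c b x₁ x₃ → CommonSets c b x₂ x₃ → CommonSets c b x₁ x₂ →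
  (Z Z' : KSubset n k) → Z ≢ Z' →
  (x₁∈Z : x₁ ∈ proj₁ Z) (x₂∈Z : x₂ ∈ proj₁ Z) → x₃ ∉ proj₁ Z →
  (x₁∈Z' : x₁ ∈ proj₁ Z') (x₂∈Z' : x₂ ∈ proj₁ Z') → x₃ ∉ proj₁ Z' →
  (W : KSubset n k) (x₁∈W : x₁ ∈ proj₁ W) → x₂ ∉ proj₁ W →
  HasMonochromaticCopy c
monochromaticCopy-triple {c = c} {b} X₁₃ X₂₃ X₁₂ Z Z' Z≢Z' x₁∈Z x₂∈Z x₃∉Z x₁∈Z' x₂∈Z' x₃∉Z' W x₁∈W x₂∉W
  with ≡-or-≡not (c _ Z x₁∈Z) b | ≡-or-≡not (c _ Z x₂∈Z) b
     | ≡-or-≡not (c _ Z' x₁∈Z') b | ≡-or-≡not (c _ Z' x₂∈Z') b | ≡-or-≡not (c _ W x₁∈W) b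
... | inj₁ e | _ | _ | _ | _ = monochromaticCopy X₁₃ Z x₁∈Z x₃∉Z e
... | inj₂ _ | inj₁ e | _ | _ | _ = monochromaticCopy X₂₃ Z x₂∈Z x₃∉Z e
... | inj₂ _ | inj₂ _ | inj₁ e | _ | _ = monochromaticCopy X₁₃ Z' x₁∈Z' x₃∉Z' e
... | inj₂ _ | inj₂ _ | inj₂ _ | inj₁ e | _ = monochromaticCopy X₂₃ Z' x₂∈Z' x₃∉Z' e
... | inj₂ _ | inj₂ _ | inj₂ _ | inj₂ _ | inj₁ e = monochromaticCopy X₁₂ W x₁∈W x₂∉W e
... | inj₂ e₁ | inj₂ e₂ | inj₂ e₃ | inj₂ e₄ | inj₂ e₅ =
  monochromaticCopy (commonSets Z Z' Z≢Z' x₁∈Z x₂∈Z x₁∈Z' x₂∈Z' e₁ e₂ e₃ e₄) W x₁∈W x₂∉W e₅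

core : Fin 5 → Fin 38
core s = s ↑ˡ 33

petal : Fin 33 → Fin 38
petal i = 5 ↑ʳ i

Y : Fin 33 → KSubset 38 6
Y i = ⊤ {5} ++ ⁅ i ⁆ , trans (∣p++q∣≡∣p∣+∣q∣ (⊤ {5}) ⁅ i ⁆) (cong (5 +_) (∣⁅x⁆∣≡1 i))

W : Fin 2 → Subset 33
W 0F = inside ∷ inside ∷ ⊥
W 1F = inside ∷ outside ∷ inside ∷ ⊥

∣W∣≡2 : ∀ a → ∣ W a ∣ ≡ 2
∣W∣≡2 0F = refl
∣W∣≡2 1F = refl

∣∁⁅s⁆++W∣≡6 : ∀ s a → ∣ ∁ ⁅ s ⁆ ++ W a ∣ ≡ 6
∣∁⁅s⁆++W∣≡6 s a = begin
  ∣ ∁ ⁅ s ⁆ ++ W a ∣    ≡⟨ ∣p++q∣≡∣p∣+∣q∣ (∁ ⁅ s ⁆) (W a) ⟩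
  ∣ ∁ ⁅ s ⁆ ∣ + ∣ W a ∣ ≡⟨ cong₂ _+_ (∣∁p∣≡n∸∣p∣ ⁅ s ⁆) (∣W∣≡2 a) ⟩
  5 ∸ ∣ ⁅ s ⁆ ∣ + 2     ≡⟨ cong (λ l → 5 ∸ l + 2) (∣⁅x⁆∣≡1 s) ⟩
  6                     ∎
  where open ≡-Reasoning

Z : Fin 5 → Fin 2 → KSubset 38 6
Z s a = ∁ ⁅ s ⁆ ++ W a , ∣∁⁅s⁆++W∣≡6 s a

core∈Y : ∀ s i → core s ∈ proj₁ (Y i)
core∈Y s i = ∈-++⁺ˡ ∈⊤

Y-injective : Injective _≡_ _≡_ Y
Y-injective {i} {j} Yi≡Yj =
  x∈⁅y⁆⇒x≡y j (∈-++⁻ʳ (⊤ {5}) (subst (λ X → petal i ∈ proj₁ X) Yi≡Yj (∈-++⁺ʳ (⊤ {5}) (x∈⁅x⁆ i))))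

core∈Z : ∀ {s t} a → s ≢ t → core s ∈ proj₁ (Z t a)
core∈Z a s≢t = ∈-++⁺ˡ (x∉p⇒x∈∁p (x≢y⇒x∉⁅y⁆ s≢t))

core∉Z : ∀ t a → core t ∉ proj₁ (Z t a)
core∉Z t a t∈Z = x∈∁p⇒x∉p (∈-++⁻ˡ t∈Z) (x∈⁅x⁆ t)

Z-distinct : ∀ t → Z t 0F ≢ Z t 1F
Z-distinct t Z₀≡Z₁
  with ∈-++⁻ʳ (∁ ⁅ t ⁆) (subst (λ X → petal 1F ∈ proj₁ X) Z₀≡Z₁ (∈-++⁺ʳ (∁ ⁅ t ⁆) (there here)))
... | there ()

edgePattern : Colouring 38 6 → Fin 33 → Fin 5 → Bool
edgePattern c i s = c (core s) (Y i) (core∈Y s i)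

copy-from-collision : (c : Colouring 38 6) {i j : Fin 33} → i ≢ j → edgePattern c i ≗ edgePattern c j →
  {b : Bool} → MonochromaticTriple (edgePattern c i) b → HasMonochromaticCopy c
copy-from-collision c {i} {j} i≢j same {b} (triple s₁ s₂ s₃ s₁≢s₂ s₁≢s₃ s₂≢s₃ e₁ e₂ e₃) =
  monochromaticCopy-triple (common e₁ e₃) (common e₂ e₃) (common e₁ e₂)
    (Z s₃ 0F) (Z s₃ 1F) (Z-distinct s₃)
    (core∈Z 0F s₁≢s₃) (core∈Z 0F s₂≢s₃) (core∉Z s₃ 0F)
    (core∈Z 1F s₁≢s₃) (core∈Z 1F s₂≢s₃) (core∉Z s₃ 1F)
    (Z s₂ 0F) (core∈Z 0F s₁≢s₂) (core∉Z s₂ 0F)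
  where
  common : ∀ {s t} → edgePattern c i s ≡ b → edgePattern c i t ≡ b → CommonSets c b (core s) (core t)
  common es et = commonSets (Y i) (Y j) (i≢j ∘ Y-injective) _ _ _ _
    es et (trans (sym (same _)) es) (trans (sym (same _)) et)

every-colouring-has-copy : (c : Colouring 38 6) → HasMonochromaticCopy c
every-colouring-has-copy c =
  let i , j , i≢j , same = boolVec-pigeonhole (edgePattern c)
      _ , mono = three-equal (edgePattern c i)
  in copy-from-collision c i≢j same mono

proposition14 : Σ ℕ (λ n → Σ ℕ (λ k → k ≤ n × ((c : Colouring n k) →
    Σ (InducedCopy n k) (λ C → ∃ (λ (col : Bool) → Monochromatic c C col)))))
proposition14 = 38 , 6 , m≤m+n 6 32 , every-colouring-has-copy
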